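{- Let $\langle T,\mathcal P\rangle$ be a representation for the pair $(G,G')$, and let $e=\{p,q\}\in E(G')$. If the contraction $(G,G')/e$ is defined, then the representation obtained from $\langle T,\mathcal P\rangle$ by replacing the two paths $P_p,P_q$ by the single path $P_p\cup P_q$ (indexed by the vertex created by the contraction) is a representation for the pair $(G,G')/e$.
   Context: A representation $\langle T,\mathcal P\rangle$: a tree $T$ and a family $\mathcal P=(P_v)_{v\in V}$ of simple paths of $T$ with at least one edge. Paths intersect if they share an edge; $\mathrm{split}(P,P')$ is the set of vertices of degree $\ge3$ in $P\cup P'$; $P\sim P'$ means intersecting with empty split set (then $P\cup P'$ is a path). A pair $(G,G')$: $V(G)=V(G')$, $E(G')\subseteq E(G)$; a representation of it satisfies $uv\in E(G)$ iff $P_u,P_v$ intersect and $uv\in E(G')$ iff $P_u\sim P_v$. For a simple graph $H$ and edge $e=\{p,q\}$, $H/e$ is the simple graph obtained by identifying $p,q$ into one vertex $p.q$ and removing loops and parallel edges. For a pair $(G,G')$ and $e\in E(G')$: if for every edge $e'\in E(G')$, $e'\ne e$, sharing an endpoint with $e$, the edge $e\,\triangle\, e'$ (joining the two non-shared endpoints) is not an edge of $G$, then $(G,G')/e:=(G/e,G'/e)$; otherwise $(G,G')/e$ is undefined. -}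

module Defs where

open import Data.Nat using (ℕ; _≤_)
open import Data.Fin using (Fin)
open import Data.List using (List; []; _∷_; _++_; [_]; length)
open import Data.List.Relation.Unary.Linked using (Linked)
open import Data.List.Relation.Unary.Unique.Propositional using (Unique)
open import Data.Product using (Σ; ∃; _×_)
open import Data.Sum using (_⊎_)
open import Relation.Nullary using (¬_)
open import Relation.Binary.PropositionalEquality using (_≡_)
open import Relation.Binary.Construct.Closure.ReflexiveTransitive using (Star)
open import Function.Bundles using (_⇔_; _↔_)

record IsSimpleGraph {V : Set} (Adj : V → V → Set) : Set where
  field
    sym    : ∀ {u v} → Adj u v → Adj v u
    irrefl : ∀ {v} → ¬ Adj v v

Finite : Set → Set
Finite V = Σ ℕ λ k → Fin k ↔ V

data Consec {A : Set} (a b : A) : List A → Set where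
  here  : ∀ {xs} → Consec a b (a ∷ b ∷ xs)
  there : ∀ {x xs} → Consec a b xs → Consec a b (x ∷ xs)

record Tree (n : ℕ) : Set₁ where
  field
    Adj       : Fin n → Fin n → Set
    simple    : IsSimpleGraph Adj
    connected : ∀ u v → Star Adj u v
    -- no cycle x, v₁, …, vₖ, y (k ≥ 1, all distinct, consecutive adjacent) closed by y ~ x
    acyclic   : ∀ x y (vs : List (Fin n)) → 1 ≤ length vs →
                Unique (x ∷ vs ++ [ y ]) → Linked Adj (x ∷ vs ++ [ y ]) → ¬ Adj y x

EdgeSet : ℕ → Set₁
EdgeSet n = Fin n → Fin n → Set

IsPath : ∀ {n} → Tree n → EdgeSet n → Set
IsPath {n} T E = ∃ λ (vs : List (Fin n)) →
  (2 ≤ length vs) × Unique vs × Linked (Tree.Adj T) vs ×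
  (∀ a b → E a b ⇔ (Consec a b vs ⊎ Consec b a vs))

_∪_ : ∀ {n} → EdgeSet n → EdgeSet n → EdgeSet n
(P ∪ Q) a b = P a b ⊎ Q a b

Intersect : ∀ {n} → EdgeSet n → EdgeSet n → Set
Intersect P Q = ∃ λ a → ∃ λ b → P a b × Q a b

-- v ∈ split(P,Q): v has degree ≥ 3 in P ∪ Q (three distinct neighbours).
InSplit : ∀ {n} → EdgeSet n → EdgeSet n → Fin n → Set
InSplit P Q v = ∃ λ w₁ → ∃ λ w₂ → ∃ λ w₃ →
  ¬ w₁ ≡ w₂ × ¬ w₁ ≡ w₃ × ¬ w₂ ≡ w₃ ×
  (P ∪ Q) v w₁ × (P ∪ Q) v w₂ × (P ∪ Q) v w₃

_∼_ : ∀ {n} → EdgeSet n → EdgeSet n → Set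
P ∼ Q = Intersect P Q × (∀ v → ¬ InSplit P Q v)

IsRepresentation : ∀ {n} → Tree n → {V : Set} →
  (G G' : V → V → Set) → (V → EdgeSet n) → Set
IsRepresentation T {V} G G' P =
  (∀ v → IsPath T (P v)) ×
  (∀ u v → ¬ u ≡ v →
     (G u v ⇔ Intersect (P u) (P v)) × (G' u v ⇔ (P u ∼ P v)))

-- Condition for (G,G')/e to be defined, e = {p,q} ∈ E(G'):
-- for every other G'-edge e' sharing an endpoint with e, e △ e' ∉ E(G).
ContractionDefined : {V : Set} → (G G' : V → V → Set) → V → V → Set
ContractionDefined {V} G G' p q =
  (∀ r → ¬ r ≡ q → G' p r → ¬ G q r) ×
  (∀ r → ¬ r ≡ p → G' q r → ¬ G p r)

-- Vertex set of H/e for e = {p,q}: V ∖ {q}; the vertex p stands for p.q.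
-- (The proof component is irrelevant, so elements with equal underlying
-- vertex are definitionally equal.)
record Contracted (V : Set) (q : V) : Set where
  constructor ⟨_,_⟩
  field
    vtx  : V
    .ne  : ¬ vtx ≡ q
open Contracted public

MapsTo : {V : Set} (p q : V) → V → Contracted V q → Set
MapsTo p q a x = a ≡ vtx x ⊎ (a ≡ q × vtx x ≡ p)

-- H/e: identify p and q, drop loops and parallel edges.
Contract : {V : Set} → (V → V → Set) → (p q : V) →
  Contracted V q → Contracted V q → Set
Contract H p q x y = ¬ vtx x ≡ vtx y ×
  ∃ λ a → ∃ λ b → H a b × MapsTo p q a x × MapsTo p q b y

ContractPaths : ∀ {n} {V : Set} → (V → EdgeSet n) → (p q : V) →
  Contracted V q → EdgeSet n
ContractPaths P p q x a b =
  (vtx x ≡ p × (P p ∪ P q) a b) ⊎ (¬ vtx x ≡ p × P (vtx x) a b)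

private
  _ : {V : Set} {q v : V} .(h h' : ¬ v ≡ q) → ⟨ v , h ⟩ ≡ ⟨ v , h' ⟩
  _ = λ _ _ → Relation.Binary.PropositionalEquality.refl

-- If P p ∼ P q, the two paths agree around a shared edge until one of them ends (a disagreement
-- would be a split vertex), and in a tree the two farthest ends glue to a simple path; so P p ∪ P q
-- is a path. Intersecting P p ∪ P q is intersecting P p or P q, matching adjacency to p.q in G/e.
-- For ∼, let P p ∼ P y. Definedness of the contraction makes P q and P y edge-disjoint, and then a
-- split vertex v of P p ∪ P q and P y is impossible: v lies on P q and P y (otherwise it splits P p
-- with one of them); it cannot be interior to P p, since then each of its neighbours in P q or P y is
-- one of its two neighbours on P p; and otherwise P p − v joins P q to P y around v, so in a tree they
-- share an edge at v.

module Submission where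

open import Data.Empty using (⊥; ⊥-elim)
import Data.Empty.Irrelevant as Irrelevant
open import Data.Fin using (Fin; _≟_)
open import Data.Fin.Properties using (inj⇒≟)
open import Data.List using (List; []; _∷_; _++_; [_]; _∷ʳ_; length; reverse; initLast; _∷ʳ′_)
open import Data.List.Membership.Propositional using (_∈_; _∉_)
open import Data.List.Membership.Propositional.Properties using (∈-++⁺ʳ; ∈-++⁻; ∈-∃++)
open import Data.List.Properties using (++-assoc; ++-identityʳ; reverse-++; reverse-involutive; unfold-reverse; ʳ++-defn)
open import Data.List.Relation.Binary.Subset.Propositional using (_⊆_)
open import Data.List.Relation.Unary.All as All using ([]; _∷_)
import Data.List.Relation.Unary.All.Properties as All
open import Data.List.Relation.Unary.AllPairs using ([]; _∷_)
open import Data.List.Relation.Unary.Any using (here; there)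
import Data.List.Relation.Unary.Any.Properties as Any
open import Data.List.Relation.Unary.Linked using (Linked; []; [-]; _∷_)
open import Data.List.Relation.Unary.Unique.Propositional using (Unique)
open import Data.List.Relation.Unary.Unique.Propositional.Properties using (++⁺; Unique[x∷xs]⇒x∉xs)
open import Data.Nat using (ℕ; _≤_; s≤s; z≤n)
open import Data.Nat.Properties using (m≤n⇒m≤1+n)
open import Data.Product as Product using (Σ; ∃; ∃-syntax; _×_; _,_; proj₁; proj₂)
open import Data.Sum as Sum using (_⊎_; inj₁; inj₂; swap)
open import Data.Sum.Function.Propositional using (_⊎-⇔_)
open import Function.Base using (id)
open import Function.Bundles using (_⇔_; mk⇔; Equivalence)
open import Function.Properties.Equivalence using (⇔-setoid)
open import Function.Properties.Inverse using (↔-sym; ↔⇒↣)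
open import Level using (0ℓ)
open import Relation.Binary.Definitions using (DecidableEquality)
open import Relation.Binary.PropositionalEquality using (_≡_; refl; sym; trans; cong; subst; ≢-sym; module ≡-Reasoning)
open import Relation.Nullary using (¬_; yes; no)

open import Defs

module _ {A : Set} where

  Consec-++ˡ : ∀ {a b : A} xs {ys} → Consec a b ys → Consec a b (xs ++ ys)
  Consec-++ˡ []       c = c
  Consec-++ˡ (_ ∷ xs) c = there (Consec-++ˡ xs c)

  Consec-++ʳ : ∀ {a b : A} {xs} ys → Consec a b xs → Consec a b (xs ++ ys)
  Consec-++ʳ ys here      = here
  Consec-++ʳ ys (there c) = there (Consec-++ʳ ys c)

  Consec⇒∈ˡ : ∀ {a b : A} {xs} → Consec a b xs → a ∈ xs
  Consec⇒∈ˡ here      = here refl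
  Consec⇒∈ˡ (there c) = there (Consec⇒∈ˡ c)

  Consec⇒∈ʳ : ∀ {a b : A} {xs} → Consec a b xs → b ∈ xs
  Consec⇒∈ʳ here      = there (here refl)
  Consec⇒∈ʳ (there c) = there (Consec⇒∈ʳ c)

  Consec-last : ∀ {u v : A} ys {zs} → Consec u v ((ys ∷ʳ u) ++ v ∷ zs)
  Consec-last []       = here
  Consec-last (_ ∷ ys) = there (Consec-last ys)

  Consec⇒long : ∀ {a b : A} {xs} → Consec a b xs → 2 ≤ length xs
  Consec⇒long here      = s≤s (s≤s z≤n)
  Consec⇒long (there c) = m≤n⇒m≤1+n (Consec⇒long c)

  Consec⇒split : ∀ {a b : A} {xs} → Consec a b xs → ∃[ L ] ∃[ R ] xs ≡ L ++ a ∷ b ∷ R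
  Consec⇒split (here {xs}) = [] , xs , refl
  Consec⇒split (there {x} c) with Consec⇒split c
  ... | L , R , refl = x ∷ L , R , refl

  Consec-junction : ∀ {c d y : A} xs zs {xs′ zs′} → Consec c d (xs ++ y ∷ zs) →
                    Consec c d (xs ++ y ∷ zs′) ⊎ Consec c d (xs′ ++ y ∷ zs)
  Consec-junction []           zs {xs′} c     = inj₂ (Consec-++ˡ xs′ c)
  Consec-junction (_ ∷ [])     zs here        = inj₁ here
  Consec-junction (_ ∷ _ ∷ xs) zs here        = inj₁ here
  Consec-junction (_ ∷ xs)     zs (there c) with Consec-junction xs zs c
  ... | inj₁ c′ = inj₁ (there c′)
  ... | inj₂ c′ = inj₂ c′

  reverse-++-∷ : ∀ (L : List A) v R → reverse (L ++ v ∷ R) ≡ reverse R ++ v ∷ reverse L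
  reverse-++-∷ L v R = trans (reverse-++ L (v ∷ R))
    (trans (cong (_++ reverse L) (ʳ++-defn R)) (++-assoc (reverse R) [ v ] (reverse L)))

  reverse-middle : ∀ (L : List A) a b R → reverse (L ++ a ∷ b ∷ R) ≡ reverse R ++ b ∷ a ∷ reverse L
  reverse-middle L a b R = trans (reverse-++ L (a ∷ b ∷ R))
    (trans (cong (_++ reverse L) (ʳ++-defn R)) (++-assoc (reverse R) (b ∷ a ∷ []) (reverse L)))

  reverse-prefix⇒suffix : ∀ (L L′ t : List A) → reverse L ≡ reverse L′ ++ t → L ≡ reverse t ++ L′
  reverse-prefix⇒suffix L L′ t eq = begin
    L                               ≡⟨ reverse-involutive L ⟨
    reverse (reverse L)             ≡⟨ cong reverse eq ⟩
    reverse (reverse L′ ++ t)       ≡⟨ reverse-++ (reverse L′) t ⟩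
    reverse t ++ reverse (reverse L′) ≡⟨ cong (reverse t ++_) (reverse-involutive L′) ⟩
    reverse t ++ L′                 ∎
    where open ≡-Reasoning

  Consec-reverse : ∀ {a b : A} {xs} → Consec a b xs → Consec b a (reverse xs)
  Consec-reverse {a} {b} c with Consec⇒split c
  ... | L , R , refl rewrite reverse-middle L a b R = Consec-++ˡ (reverse R) here

  Consec-reverse⁻ : ∀ {a b : A} {xs} → Consec a b (reverse xs) → Consec b a xs
  Consec-reverse⁻ {xs = xs} c = subst (Consec _ _) (reverse-involutive xs) (Consec-reverse c)

  Infix : List A → List A → Set
  Infix xs ys = ∃[ t ] ∃[ u ] ys ≡ t ++ xs ++ u

  Consec-infix : ∀ {a b : A} {xs ys} → Infix xs ys → Consec a b xs → Consec a b ys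
  Consec-infix (t , u , refl) c = Consec-++ˡ t (Consec-++ʳ u c)

  Infix-extend : ∀ {a b : A} {L R LA RB} t u → LA ≡ t ++ L → RB ≡ R ++ u →
                 Infix (L ++ a ∷ b ∷ R) (LA ++ a ∷ b ∷ RB)
  Infix-extend {a} {b} {L} {R} t u refl refl =
    t , u , trans (++-assoc t L _) (cong (t ++_) (sym (++-assoc L (a ∷ b ∷ R) u)))

  Along : (A → A → Set) → List A → Set
  Along R xs = ∀ {a b} → Consec a b xs → R a b

  Linked⇒Along : ∀ {R xs} → Linked R xs → Along R xs
  Linked⇒Along (r ∷ _) here      = r
  Linked⇒Along (_ ∷ l) (there c) = Linked⇒Along l c
  Linked⇒Along [-]     (there ())

  Along⇒Linked : ∀ {R} xs → Along R xs → Linked R xs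
  Along⇒Linked []           _ = []
  Along⇒Linked (_ ∷ [])     _ = [-]
  Along⇒Linked (_ ∷ _ ∷ xs) f = f here ∷ Along⇒Linked (_ ∷ xs) (λ c → f (there c))

  Along-++⁻ˡ : ∀ {R} xs {ys} → Along R (xs ++ ys) → Along R xs
  Along-++⁻ˡ xs {ys} f c = f (Consec-++ʳ ys c)

  Along-++⁻ʳ : ∀ {R} xs {ys} → Along R (xs ++ ys) → Along R ys
  Along-++⁻ʳ xs f c = f (Consec-++ˡ xs c)

  Along-reverse : ∀ {R xs} → (∀ {a b} → R a b → R b a) → Along R xs → Along R (reverse xs)
  Along-reverse sym f c = sym (f (Consec-reverse⁻ c))

  Along-junction : ∀ {R y} xs zs {xs′ zs′} →
                   Along R (xs ++ y ∷ zs′) → Along R (xs′ ++ y ∷ zs) → Along R (xs ++ y ∷ zs)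
  Along-junction xs zs f g c with Consec-junction xs zs c
  ... | inj₁ c′ = f c′
  ... | inj₂ c′ = g c′

  unique-++⁻ˡ : ∀ (xs : List A) {ys} → Unique (xs ++ ys) → Unique xs
  unique-++⁻ˡ []       _        = []
  unique-++⁻ˡ (_ ∷ xs) (x∉ ∷ u) = All.++⁻ˡ xs x∉ ∷ unique-++⁻ˡ xs u

  unique-++⁻ʳ : ∀ (xs : List A) {ys} → Unique (xs ++ ys) → Unique ys
  unique-++⁻ʳ []       u       = u
  unique-++⁻ʳ (_ ∷ xs) (_ ∷ u) = unique-++⁻ʳ xs u

  unique-++⇒disjoint : ∀ (xs : List A) {ys v} → Unique (xs ++ ys) → v ∈ xs → v ∉ ys
  unique-++⇒disjoint (_ ∷ xs) (x∉ ∷ _) (here refl) v∈ys = All.lookup x∉ (∈-++⁺ʳ xs v∈ys) refl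
  unique-++⇒disjoint (_ ∷ xs) (_ ∷ u)  (there v∈xs) v∈ys = unique-++⇒disjoint xs u v∈xs v∈ys

  unique-reverse : ∀ {xs : List A} → Unique xs → Unique (reverse xs)
  unique-reverse {[]}     _        = []
  unique-reverse {x ∷ xs} (x∉ ∷ u) rewrite unfold-reverse x xs =
    ++⁺ (unique-reverse u) ([] ∷ []) λ { (x∈ , here refl) → All.lookup x∉ (Any.reverse⁻ x∈) refl }

  three-among-two : ∀ {w₁ w₂ w₃ u₁ u₂ : A} → ¬ w₁ ≡ w₂ → ¬ w₁ ≡ w₃ → ¬ w₂ ≡ w₃ →
                    w₁ ≡ u₁ ⊎ w₁ ≡ u₂ → w₂ ≡ u₁ ⊎ w₂ ≡ u₂ → w₃ ≡ u₁ ⊎ w₃ ≡ u₂ → ⊥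
  three-among-two ≢₁₂ _   _   (inj₁ refl) (inj₁ refl) _           = ≢₁₂ refl
  three-among-two ≢₁₂ _   _   (inj₂ refl) (inj₂ refl) _           = ≢₁₂ refl
  three-among-two _   ≢₁₃ _   (inj₁ refl) (inj₂ refl) (inj₁ refl) = ≢₁₃ refl
  three-among-two _   ≢₁₃ _   (inj₂ refl) (inj₁ refl) (inj₂ refl) = ≢₁₃ refl
  three-among-two _   _   ≢₂₃ (inj₁ refl) (inj₂ refl) (inj₂ refl) = ≢₂₃ refl
  three-among-two _   _   ≢₂₃ (inj₂ refl) (inj₁ refl) (inj₁ refl) = ≢₂₃ refl

module _ {n : ℕ} where

  infix 4 _⊆ᴱ_ _≐_

  _⊆ᴱ_ : EdgeSet n → EdgeSet n → Set
  E ⊆ᴱ F = ∀ {a b} → E a b → F a b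

  _≐_ : EdgeSet n → EdgeSet n → Set
  E ≐ F = E ⊆ᴱ F × F ⊆ᴱ E

  ≐-refl : ∀ {E : EdgeSet n} → E ≐ E
  ≐-refl = id , id

  ∪-comm : ∀ {E F : EdgeSet n} → E ∪ F ≐ F ∪ E
  ∪-comm = swap , swap

  Intersect-mono : ∀ {E E′ F F′ : EdgeSet n} → E ⊆ᴱ E′ → F ⊆ᴱ F′ → Intersect E F → Intersect E′ F′
  Intersect-mono E⊆E′ F⊆F′ (a , b , e , f) = a , b , E⊆E′ e , F⊆F′ f

  Intersect-sym : ∀ {E F : EdgeSet n} → Intersect E F → Intersect F E
  Intersect-sym (a , b , e , f) = a , b , f , e

  Intersect-comm : ∀ {E F : EdgeSet n} → Intersect E F ⇔ Intersect F E
  Intersect-comm = mk⇔ Intersect-sym Intersect-sym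

  Intersect-cong : ∀ {E E′ F F′ : EdgeSet n} → E ≐ E′ → F ≐ F′ → Intersect E F ⇔ Intersect E′ F′
  Intersect-cong (E⊆E′ , E′⊆E) (F⊆F′ , F′⊆F) =
    mk⇔ (Intersect-mono E⊆E′ F⊆F′) (Intersect-mono E′⊆E F′⊆F)

  Intersect-∪ : ∀ {E E′ F : EdgeSet n} → Intersect (E ∪ E′) F ⇔ (Intersect E F ⊎ Intersect E′ F)
  Intersect-∪ = mk⇔
    (λ { (a , b , inj₁ e , f) → inj₁ (a , b , e , f) ; (a , b , inj₂ e , f) → inj₂ (a , b , e , f) })
    (λ { (inj₁ (a , b , e , f)) → a , b , inj₁ e , f ; (inj₂ (a , b , e , f)) → a , b , inj₂ e , f })

  InSplit-map : ∀ {E F E′ F′ : EdgeSet n} {v} → (∀ {w} → (E ∪ F) v w → (E′ ∪ F′) v w) →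
                InSplit E F v → InSplit E′ F′ v
  InSplit-map f (w₁ , w₂ , w₃ , ≢₁₂ , ≢₁₃ , ≢₂₃ , e₁ , e₂ , e₃) =
    w₁ , w₂ , w₃ , ≢₁₂ , ≢₁₃ , ≢₂₃ , f e₁ , f e₂ , f e₃

  ∼-sym : ∀ {E F : EdgeSet n} → E ∼ F → F ∼ E
  ∼-sym {E} {F} (i , no-split) =
    Intersect-sym i , λ v s → no-split v (InSplit-map {E = F} {F = E} {E′ = E} {F′ = F} swap s)

  ∼-comm : ∀ {E F : EdgeSet n} → E ∼ F ⇔ F ∼ E
  ∼-comm = mk⇔ ∼-sym ∼-sym

  ∼-mono : ∀ {E E′ F F′ : EdgeSet n} → E ⊆ᴱ E′ → F ⊆ᴱ F′ → Intersect E F → E′ ∼ F′ → E ∼ F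
  ∼-mono {E} {E′} {F} {F′} E⊆E′ F⊆F′ i (_ , no-split) =
    i , λ v s → no-split v (InSplit-map {E = E} {F = F} {E′ = E′} {F′ = F′} (Sum.map E⊆E′ F⊆F′) s)

  ∼-cong : ∀ {E E′ F F′ : EdgeSet n} → E ≐ E′ → F ≐ F′ → E ∼ F ⇔ E′ ∼ F′
  ∼-cong (E⊆E′ , E′⊆E) (F⊆F′ , F′⊆F) =
    mk⇔ (λ E∼F → ∼-mono E′⊆E F′⊆F (Intersect-mono E⊆E′ F⊆F′ (proj₁ E∼F)) E∼F)
        (λ E′∼F′ → ∼-mono E⊆E′ F⊆F′ (Intersect-mono E′⊆E F′⊆F (proj₁ E′∼F′)) E′∼F′)

  -- A disagreement after v would give v the three distinct neighbours w, x, y in P ∪ Q.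
  trails-comparable : ∀ {P Q : EdgeSet n} → (∀ {a b} → P a b → P b a) → (∀ v → ¬ InSplit P Q v) →
                      ∀ w v s₁ s₂ → Unique (w ∷ v ∷ s₁) → Unique (w ∷ v ∷ s₂) →
                      Along P (w ∷ v ∷ s₁) → Along Q (w ∷ v ∷ s₂) →
                      (∃[ t ] s₁ ≡ s₂ ++ t) ⊎ (∃[ t ] s₂ ≡ s₁ ++ t)
  trails-comparable _ _ w v []       s₂       _ _ _ _ = inj₂ (s₂ , refl)
  trails-comparable _ _ w v (x ∷ s₁) []       _ _ _ _ = inj₁ (x ∷ s₁ , refl)
  trails-comparable P-sym no-split w v (x ∷ s₁) (y ∷ s₂)
                    ((_ ∷ w≢x ∷ _) ∷ u₁) ((_ ∷ w≢y ∷ _) ∷ u₂) P-along Q-along with x ≟ y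
  ... | yes refl = Sum.map (Product.map₂ (cong (x ∷_))) (Product.map₂ (cong (x ∷_)))
                     (trails-comparable P-sym no-split v x s₁ s₂ u₁ u₂
                       (λ c → P-along (there c)) (λ c → Q-along (there c)))
  ... | no x≢y = ⊥-elim (no-split v (w , x , y , w≢x , w≢y , x≢y ,
                   inj₁ (P-sym (P-along here)) , inj₁ (P-along (there here)) , inj₂ (Q-along (there here))))

module TreePaths {n : ℕ} (T : Tree n) where

  open Tree T
  open import Data.List.Membership.DecPropositional (_≟_ {n}) using (_∈?_)

  Adj-sym : ∀ {x y} → Adj x y → Adj y x
  Adj-sym = IsSimpleGraph.sym simple

  IsPath-cong : ∀ {E F : EdgeSet n} → E ≐ F → IsPath T E → IsPath T F
  IsPath-cong (E⊆F , F⊆E) (xs , long , unique , linked , edge⇔) =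
    xs , long , unique , linked , λ a b → mk⇔ (λ f → Equivalence.to (edge⇔ a b) (F⊆E f))
                                             (λ s → E⊆F (Equivalence.from (edge⇔ a b) s))

  infixr 5 _∷_ _++ʷ_

  data Walk : Fin n → Fin n → Set where
    []  : ∀ {x} → Walk x x
    _∷_ : ∀ {x y z} → Adj x y → Walk y z → Walk x z

  vertices : ∀ {x y} → Walk x y → List (Fin n)
  vertices {x} []      = [ x ]
  vertices {x} (_ ∷ w) = x ∷ vertices w

  _++ʷ_ : ∀ {x y z} → Walk x y → Walk y z → Walk x z
  []      ++ʷ w′ = w′
  (e ∷ w) ++ʷ w′ = e ∷ (w ++ʷ w′)

  reverseʷ : ∀ {x y} → Walk x y → Walk y x
  reverseʷ []      = []
  reverseʷ (e ∷ w) = reverseʷ w ++ʷ (Adj-sym e ∷ [])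

  start∈ : ∀ {x y} (w : Walk x y) → x ∈ vertices w
  start∈ []      = here refl
  start∈ (_ ∷ _) = here refl

  ∈-++ʷ⁻ : ∀ {x y z v} (w : Walk x y) (w′ : Walk y z) →
           v ∈ vertices (w ++ʷ w′) → v ∈ vertices w ⊎ v ∈ vertices w′
  ∈-++ʷ⁻ []      w′ v∈ = inj₂ v∈
  ∈-++ʷ⁻ (_ ∷ w) w′ (here refl) = inj₁ (here refl)
  ∈-++ʷ⁻ (_ ∷ w) w′ (there v∈) with ∈-++ʷ⁻ w w′ v∈
  ... | inj₁ v∈w  = inj₁ (there v∈w)
  ... | inj₂ v∈w′ = inj₂ v∈w′

  ∈-reverseʷ⁻ : ∀ {x y v} (w : Walk x y) → v ∈ vertices (reverseʷ w) → v ∈ vertices w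
  ∈-reverseʷ⁻ []      v∈ = v∈
  ∈-reverseʷ⁻ (e ∷ w) v∈ with ∈-++ʷ⁻ (reverseʷ w) (Adj-sym e ∷ []) v∈
  ... | inj₁ v∈w                = there (∈-reverseʷ⁻ w v∈w)
  ... | inj₂ (here refl)        = there (start∈ w)
  ... | inj₂ (there (here refl)) = here refl

  Along-vertices : ∀ {x y} (w : Walk x y) → Along Adj (vertices w)
  Along-vertices []          (there ())
  Along-vertices (e ∷ [])    here       = e
  Along-vertices (_ ∷ [])    (there (there ()))
  Along-vertices (e ∷ _ ∷ _) here       = e
  Along-vertices (_ ∷ e ∷ w) (there c)  = Along-vertices (e ∷ w) c

  vertices-last : ∀ {x y} (w : Walk x y) → ∃[ vs ] vertices w ≡ vs ++ [ y ]
  vertices-last []      = [] , refl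
  vertices-last {x} (_ ∷ w) with vertices-last w
  ... | vs , eq = x ∷ vs , cong (x ∷_) eq

  dropUntil : ∀ {x y z} (w : Walk y z) → x ∈ vertices w →
              Σ (Walk x z) λ w′ → ∃[ pre ] vertices w ≡ pre ++ vertices w′
  dropUntil []      (here refl)  = [] , [] , refl
  dropUntil (e ∷ w) (here refl)  = e ∷ w , [] , refl
  dropUntil {y = y} (_ ∷ w) (there x∈) with dropUntil w x∈
  ... | w′ , pre , eq = w′ , y ∷ pre , cong (y ∷_) eq

  loopErase : ∀ {x y} (w : Walk x y) →
              Σ (Walk x y) λ w′ → Unique (vertices w′) × vertices w′ ⊆ vertices w
  loopErase []                = [] , [] ∷ [] , id
  loopErase {x} (e ∷ w) with loopErase w
  ... | w′ , u , w′⊆w with x ∈? vertices w′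
  ...   | no x∉ = e ∷ w′ , All.¬Any⇒All¬ _ x∉ ∷ u ,
                  λ { (here refl) → here refl ; (there v∈) → there (w′⊆w v∈) }
  ...   | yes x∈ with dropUntil w′ x∈
  ...     | w″ , pre , eq = w″ , unique-++⁻ʳ pre (subst Unique eq u) ,
                            λ v∈ → there (w′⊆w (subst (_ ∈_) (sym eq) (∈-++⁺ʳ pre v∈)))

  walk-between-neighbours-visits : ∀ {v x y} → Adj v x → Adj v y → ¬ x ≡ y →
                                   (w : Walk x y) → v ∈ vertices w
  walk-between-neighbours-visits {v} {x} {y} vx vy x≢y w with v ∈? vertices w
  ... | yes v∈ = v∈
  ... | no v∉ with loopErase w
  ...   | [] , _ , _ = ⊥-elim (x≢y refl)
  ...   | e ∷ w′ , u , w′⊆w with vertices-last w′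
  ...     | vs , eq = ⊥-elim (acyclic v y (x ∷ vs) (s≤s z≤n)
              (subst (λ l → Unique (v ∷ x ∷ l)) eq (All.¬Any⇒All¬ _ (λ v∈ → v∉ (w′⊆w v∈)) ∷ u))
              (subst (λ l → Linked Adj (v ∷ x ∷ l)) eq
                 (Along⇒Linked (v ∷ vertices (e ∷ w′)) λ { here → vx ; (there c) → Along-vertices (e ∷ w′) c }))
              (Adj-sym vy))

  walk-from-head : ∀ {h a xs} → Along Adj (h ∷ xs) → a ∈ h ∷ xs →
                   Σ (Walk h a) λ w → vertices w ⊆ h ∷ xs
  walk-from-head _ (here refl) = [] , λ { (here refl) → here refl }
  walk-from-head {xs = _ ∷ _} adj (there a∈) with walk-from-head (λ c → adj (there c)) a∈
  ... | w , w⊆ = adj here ∷ w , λ { (here refl) → here refl ; (there v∈) → there (w⊆ v∈) }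

  walk-within : ∀ {xs a c} → Along Adj xs → a ∈ xs → c ∈ xs → Σ (Walk a c) λ w → vertices w ⊆ xs
  walk-within {_ ∷ _} adj a∈ c∈ with walk-from-head adj a∈ | walk-from-head adj c∈
  ... | wa , wa⊆ | wc , wc⊆ = reverseʷ wa ++ʷ wc , λ v∈ → inside (∈-++ʷ⁻ (reverseʷ wa) wc v∈)
    where
    inside : ∀ {v} → v ∈ vertices (reverseʷ wa) ⊎ v ∈ vertices wc → v ∈ _
    inside (inj₁ v∈) = wa⊆ (∈-reverseʷ⁻ wa v∈)
    inside (inj₂ v∈) = wc⊆ v∈

  Step : List (Fin n) → EdgeSet n
  Step xs a b = Consec a b xs ⊎ Consec b a xs

  record Traces (E : EdgeSet n) (xs : List (Fin n)) : Set where
    field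
      unique   : Unique xs
      adjacent : Along Adj xs
      edge⇔    : ∀ a b → E a b ⇔ Step xs a b

  toTraces : ∀ {E} → IsPath T E → ∃ (Traces E)
  toTraces (xs , _ , unique , linked , edge⇔) = xs , record
    { unique = unique ; adjacent = Linked⇒Along linked ; edge⇔ = edge⇔ }

  module _ {E : EdgeSet n} {xs : List (Fin n)} (A : Traces E xs) where
    open Traces A

    edge⇒Step : ∀ {a b} → E a b → Step xs a b
    edge⇒Step {a} {b} = Equivalence.to (edge⇔ a b)

    Step⇒edge : ∀ {a b} → Step xs a b → E a b
    Step⇒edge {a} {b} = Equivalence.from (edge⇔ a b)

    Along-edges : Along E xs
    Along-edges c = Step⇒edge (inj₁ c)

    edge-sym : ∀ {a b} → E a b → E b a
    edge-sym e with edge⇒Step e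
    ... | inj₁ c = Step⇒edge (inj₂ c)
    ... | inj₂ c = Step⇒edge (inj₁ c)

    edge⇒∈ : ∀ {a b} → E a b → a ∈ xs
    edge⇒∈ e with edge⇒Step e
    ... | inj₁ c = Consec⇒∈ˡ c
    ... | inj₂ c = Consec⇒∈ʳ c

    edge⇒Adj : ∀ {a b} → E a b → Adj a b
    edge⇒Adj e with edge⇒Step e
    ... | inj₁ c = adjacent c
    ... | inj₂ c = Adj-sym (adjacent c)

    edge⇒≢ : ∀ {a b} → E a b → ¬ a ≡ b
    edge⇒≢ e refl = IsSimpleGraph.irrefl simple (edge⇒Adj e)

  Traces-reverse : ∀ {E xs} → Traces E xs → Traces E (reverse xs)
  Traces-reverse {xs = xs} A = record
    { unique   = unique-reverse unique
    ; adjacent = Along-reverse Adj-sym adjacent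
    ; edge⇔    = λ a b → mk⇔ (λ e → flip (edge⇒Step A e)) (λ s → Step⇒edge A (unflip s))
    }
    where
    open Traces A
    flip : ∀ {a b} → Step xs a b → Step (reverse xs) a b
    flip (inj₁ c) = inj₂ (Consec-reverse c)
    flip (inj₂ c) = inj₁ (Consec-reverse c)
    unflip : ∀ {a b} → Step (reverse xs) a b → Step xs a b
    unflip (inj₁ c) = inj₂ (Consec-reverse⁻ c)
    unflip (inj₂ c) = inj₁ (Consec-reverse⁻ c)

  step-forward : ∀ {E v a} pre {post} → Traces E (pre ++ v ∷ post) → a ∈ post →
                 ∃[ x ] E v x × Σ (Walk x a) λ w → v ∉ vertices w
  step-forward {v = v} {a} pre {x ∷ post} A a∈ =
    x , Along-edges A (Consec-++ˡ pre here) ,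
    avoiding (walk-within (λ c → adjacent (Consec-++ˡ pre (there c))) (here refl) a∈)
    where
    open Traces A
    avoiding : Σ (Walk x a) (λ w → vertices w ⊆ x ∷ post) → Σ (Walk x a) λ w → v ∉ vertices w
    avoiding (w , w⊆) = w , λ v∈ → Unique[x∷xs]⇒x∉xs (unique-++⁻ʳ pre unique) (w⊆ v∈)

  step-towards : ∀ {E xs v a} → Traces E xs → v ∈ xs → a ∈ xs → ¬ a ≡ v →
                 ∃[ x ] E v x × Σ (Walk x a) λ w → v ∉ vertices w
  step-towards {v = v} {a} A v∈ a∈ a≢v with ∈-∃++ v∈
  ... | pre , post , refl with ∈-++⁻ pre a∈
  ...   | inj₂ (here a≡v)     = ⊥-elim (a≢v a≡v)
  ...   | inj₂ (there a∈post) = step-forward pre A a∈post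
  ...   | inj₁ a∈pre          = step-forward (reverse post)
                                   (subst (Traces _) (reverse-++-∷ pre v post) (Traces-reverse A))
                                   (Any.reverse⁺ a∈pre)

  -- Otherwise the two exits from v, joined through w, would close a cycle through v.
  common-edge-at : ∀ {E F xs zs v a c} → Traces E xs → Traces F zs →
                   v ∈ xs → a ∈ xs → ¬ a ≡ v → v ∈ zs → c ∈ zs → ¬ c ≡ v →
                   (w : Walk a c) → v ∉ vertices w → ∃[ x ] E v x × F v x
  common-edge-at {v = v} A B v∈xs a∈ a≢v v∈zs c∈ c≢v w v∉w
    with step-towards A v∈xs a∈ a≢v | step-towards B v∈zs c∈ c≢v
  ... | x , vx , wx , v∉wx | z , vz , wz , v∉wz with x ≟ z
  ...   | yes refl = x , vx , vz
  ...   | no x≢z   = ⊥-elim (v∉cycle (walk-between-neighbours-visits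
                                      (edge⇒Adj A vx) (edge⇒Adj B vz) x≢z (wx ++ʷ w ++ʷ reverseʷ wz)))
    where
    v∉cycle : v ∉ vertices (wx ++ʷ w ++ʷ reverseʷ wz)
    v∉cycle v∈ with ∈-++ʷ⁻ wx _ v∈
    ... | inj₁ v∈wx = v∉wx v∈wx
    ... | inj₂ v∈′ with ∈-++ʷ⁻ w (reverseʷ wz) v∈′
    ...   | inj₁ v∈w  = v∉w v∈w
    ...   | inj₂ v∈wz = v∉wz (∈-reverseʷ⁻ wz v∈wz)

  data Position (xs : List (Fin n)) (v : Fin n) : Set where
    interior   : ∀ {u₁ u₂} → Consec u₁ v xs → Consec v u₂ xs → ¬ u₁ ≡ u₂ → Position xs v
    peripheral : ∀ ws → Along Adj ws → v ∉ ws → (∀ {z} → z ∈ xs → ¬ z ≡ v → z ∈ ws) → Position xs v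

  position : ∀ {xs} → Unique xs → Along Adj xs → ∀ v → Position xs v
  position {xs} u adj v with v ∈? xs
  ... | no v∉ = peripheral xs adj v∉ (λ z∈ _ → z∈)
  ... | yes v∈ with ∈-∃++ v∈
  ...   | pre , post , refl = around pre post u adj
    where
    around : ∀ pre post → Unique (pre ++ v ∷ post) → Along Adj (pre ++ v ∷ post) → Position (pre ++ v ∷ post) v
    around pre post u adj with initLast pre | post
    ... | [] | post = peripheral post (λ c → adj (there c)) (Unique[x∷xs]⇒x∉xs u) rest
      where
      rest : ∀ {z} → z ∈ v ∷ post → ¬ z ≡ v → z ∈ post
      rest (here z≡v) z≢v = ⊥-elim (z≢v z≡v)
      rest (there z∈) _   = z∈
    ... | ys ∷ʳ′ u₁ | [] = peripheral (ys ∷ʳ u₁) (Along-++⁻ˡ (ys ∷ʳ u₁) adj)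
                            (λ v∈ → unique-++⇒disjoint (ys ∷ʳ u₁) u v∈ (here refl)) rest
      where
      rest : ∀ {z} → z ∈ (ys ∷ʳ u₁) ++ [ v ] → ¬ z ≡ v → z ∈ ys ∷ʳ u₁
      rest z∈ z≢v with ∈-++⁻ (ys ∷ʳ u₁) z∈
      ... | inj₁ z∈′         = z∈′
      ... | inj₂ (here z≡v) = ⊥-elim (z≢v z≡v)
    ... | ys ∷ʳ′ u₁ | u₂ ∷ post′ =
      interior (Consec-last ys) (Consec-++ˡ (ys ∷ʳ u₁) here)
        (λ { refl → unique-++⇒disjoint (ys ∷ʳ u₁) u (∈-++⁺ʳ ys (here refl)) (there (here refl)) })

  -- A vertex common to both sides would close a cycle through a.
  glue-unique : ∀ {a b} L {R′ L′} R → Unique (L ++ a ∷ b ∷ R′) → Along Adj (L ++ a ∷ b ∷ R′) →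
                Unique (L′ ++ a ∷ b ∷ R) → Along Adj (L′ ++ a ∷ b ∷ R) → Unique (L ++ a ∷ b ∷ R)
  glue-unique {a} {b} L {R′} {L′} R u adj u′ adj′ =
    ++⁺ (unique-++⁻ˡ L u) (unique-++⁻ʳ L′ u′) (λ (v∈L , v∈abR) → apart L u adj v∈L v∈abR)
    where
    a∉bR : a ∉ b ∷ R
    a∉bR = Unique[x∷xs]⇒x∉xs (unique-++⁻ʳ L′ u′)
    b∷R-adjacent : Along Adj (b ∷ R)
    b∷R-adjacent c = adj′ (Consec-++ˡ L′ (there c))
    apart : ∀ L → Unique (L ++ a ∷ b ∷ R′) → Along Adj (L ++ a ∷ b ∷ R′) → ∀ {v} → v ∈ L → v ∉ a ∷ b ∷ R
    apart L u _ v∈L (here refl)         = unique-++⇒disjoint L u v∈L (here refl)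
    apart L u _ v∈L (there (here refl)) = unique-++⇒disjoint L u v∈L (there (here refl))
    apart L u adj v∈L (there (there v∈R)) with initLast L
    ... | ys ∷ʳ′ l with walk-within (Along-++⁻ˡ (ys ∷ʳ l) adj) (∈-++⁺ʳ ys (here refl)) v∈L
                      | walk-within b∷R-adjacent (there v∈R) (here refl)
    ...   | wl , wl⊆ | wb , wb⊆ = a∉cycle (walk-between-neighbours-visits
              (Adj-sym (adj (Consec-last ys))) (adj′ (Consec-++ˡ L′ here)) l≢b (wl ++ʷ wb))
      where
      l≢b : ¬ l ≡ b
      l≢b refl = unique-++⇒disjoint (ys ∷ʳ l) u (∈-++⁺ʳ ys (here refl)) (there (here refl))
      a∉cycle : a ∉ vertices (wl ++ʷ wb)
      a∉cycle a∈ with ∈-++ʷ⁻ wl wb a∈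
      ... | inj₁ a∈l = unique-++⇒disjoint (ys ∷ʳ l) u (wl⊆ a∈l) (here refl)
      ... | inj₂ a∈b = a∉bR (wb⊆ a∈b)

  orient : ∀ {E xs a b} → Traces E xs → E a b → ∃[ ys ] Traces E ys × Consec a b ys
  orient {xs = xs} A e with edge⇒Step A e
  ... | inj₁ c = xs , A , c
  ... | inj₂ c = reverse xs , Traces-reverse A , Consec-reverse c

  module _ {P Q : EdgeSet n} {xs zs} (A : Traces P xs) (B : Traces Q zs) where

    covering-path : ∀ {M} → 2 ≤ length M → Unique M → Along Adj M → Along (P ∪ Q) M →
                    Infix xs M → Infix zs M → IsPath T (P ∪ Q)
    covering-path {M} long u adj along xs⊆M zs⊆M = M , long , u , Along⇒Linked M adj , λ a b → mk⇔ to from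
      where
      embed : ∀ {E ys} → Infix ys M → Traces E ys → ∀ {a b} → E a b → Step M a b
      embed ys⊆M Y e = Sum.map (Consec-infix ys⊆M) (Consec-infix ys⊆M) (edge⇒Step Y e)
      to : ∀ {a b} → (P ∪ Q) a b → Step M a b
      to (inj₁ p) = embed xs⊆M A p
      to (inj₂ q) = embed zs⊆M B q
      from : ∀ {a b} → Step M a b → (P ∪ Q) a b
      from (inj₁ c) = along c
      from (inj₂ c) = Sum.map (edge-sym A) (edge-sym B) (along c)

    glued : ∀ {a b E₁ E₂} LA {RA LB} RB → E₁ ⊆ᴱ P ∪ Q → E₂ ⊆ᴱ P ∪ Q →
            Traces E₁ (LA ++ a ∷ b ∷ RA) → Traces E₂ (LB ++ a ∷ b ∷ RB) →
            Infix xs (LA ++ a ∷ b ∷ RB) → Infix zs (LA ++ a ∷ b ∷ RB) → IsPath T (P ∪ Q)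
    glued {b = b} LA RB E₁⊆ E₂⊆ X Y =
      covering-path (Consec⇒long (Consec-++ˡ LA here))
        (glue-unique LA RB (Traces.unique X) (Traces.adjacent X) (Traces.unique Y) (Traces.adjacent Y))
        (Along-junction LA (b ∷ RB) (Traces.adjacent X) (Traces.adjacent Y))
        (Along-junction LA (b ∷ RB) (λ c → E₁⊆ (Along-edges X c)) (λ c → E₂⊆ (Along-edges Y c)))

  -- The two paths agree around ab, so their union runs from the farther left end to the farther right end.
  union-aligned : ∀ {P Q a b} L₁ R₁ L₂ R₂ → Traces P (L₁ ++ a ∷ b ∷ R₁) → Traces Q (L₂ ++ a ∷ b ∷ R₂) →
                  (∀ v → ¬ InSplit P Q v) → IsPath T (P ∪ Q)
  union-aligned {P} {Q} {a} {b} L₁ R₁ L₂ R₂ A B no-split = assemble leftward rightward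
    where
    rightward = trails-comparable (edge-sym A) no-split a b R₁ R₂
                  (unique-++⁻ʳ L₁ (Traces.unique A)) (unique-++⁻ʳ L₂ (Traces.unique B))
                  (Along-++⁻ʳ L₁ (Along-edges A)) (Along-++⁻ʳ L₂ (Along-edges B))
    A⁻ : Traces P (reverse R₁ ++ b ∷ a ∷ reverse L₁)
    A⁻ = subst (Traces P) (reverse-middle L₁ a b R₁) (Traces-reverse A)
    B⁻ : Traces Q (reverse R₂ ++ b ∷ a ∷ reverse L₂)
    B⁻ = subst (Traces Q) (reverse-middle L₂ a b R₂) (Traces-reverse B)
    leftward = trails-comparable (edge-sym A) no-split b a (reverse L₁) (reverse L₂)
                 (unique-++⁻ʳ (reverse R₁) (Traces.unique A⁻)) (unique-++⁻ʳ (reverse R₂) (Traces.unique B⁻))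
                 (Along-++⁻ʳ (reverse R₁) (Along-edges A⁻)) (Along-++⁻ʳ (reverse R₂) (Along-edges B⁻))
    assemble : (∃[ t ] reverse L₁ ≡ reverse L₂ ++ t) ⊎ (∃[ t ] reverse L₂ ≡ reverse L₁ ++ t) →
               (∃[ u ] R₁ ≡ R₂ ++ u) ⊎ (∃[ u ] R₂ ≡ R₁ ++ u) → IsPath T (P ∪ Q)
    assemble (inj₁ (t , l)) (inj₁ (u , r)) =
      glued A B L₁ R₁ inj₁ inj₁ A A
        (Infix-extend [] [] refl (sym (++-identityʳ R₁)))
        (Infix-extend (reverse t) u (reverse-prefix⇒suffix L₁ L₂ t l) r)
    assemble (inj₁ (t , l)) (inj₂ (u , r)) =
      glued A B L₁ R₂ inj₁ inj₂ A B
        (Infix-extend [] u refl r)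
        (Infix-extend (reverse t) [] (reverse-prefix⇒suffix L₁ L₂ t l) (sym (++-identityʳ R₂)))
    assemble (inj₂ (t , l)) (inj₁ (u , r)) =
      glued A B L₂ R₁ inj₂ inj₁ B A
        (Infix-extend (reverse t) [] (reverse-prefix⇒suffix L₂ L₁ t l) (sym (++-identityʳ R₁)))
        (Infix-extend [] u refl r)
    assemble (inj₂ (t , l)) (inj₂ (u , r)) =
      glued A B L₂ R₂ inj₂ inj₂ B B
        (Infix-extend (reverse t) u (reverse-prefix⇒suffix L₂ L₁ t l) r)
        (Infix-extend [] [] refl (sym (++-identityʳ R₂)))

  union-path : ∀ {P Q} → IsPath T P → IsPath T Q → P ∼ Q → IsPath T (P ∪ Q)
  union-path πP πQ ((a , b , pab , qab) , no-split) with toTraces πP | toTraces πQ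
  ... | _ , A | _ , B with orient A pab | orient B qab
  ...   | _ , A′ , ab∈A | _ , B′ , ab∈B with Consec⇒split ab∈A | Consec⇒split ab∈B
  ...     | L₁ , R₁ , refl | L₂ , R₂ , refl = union-aligned L₁ R₁ L₂ R₂ A′ B′ no-split

  trapped : ∀ {P F xs u₁ v u₂ w} → Traces P xs → Consec u₁ v xs → Consec v u₂ xs → ¬ u₁ ≡ u₂ →
            ¬ InSplit P F v → (P ∪ F) v w → w ≡ u₁ ⊎ w ≡ u₂
  trapped {u₁ = u₁} {u₂ = u₂} {w} A u₁v vu₂ u₁≢u₂ no-split e with w ≟ u₁ | w ≟ u₂
  ... | yes w≡u₁ | _        = inj₁ w≡u₁
  ... | no _     | yes w≡u₂ = inj₂ w≡u₂
  ... | no w≢u₁  | no w≢u₂  = ⊥-elim (no-split (u₁ , u₂ , w , u₁≢u₂ , ≢-sym w≢u₁ , ≢-sym w≢u₂ ,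
                                inj₁ (Step⇒edge A (inj₂ u₁v)) , inj₁ (Step⇒edge A (inj₁ vu₂)) , e))

  no-split-interior : ∀ {P Q Y xs u₁ v u₂} → Traces P xs → Consec u₁ v xs → Consec v u₂ xs → ¬ u₁ ≡ u₂ →
                      ¬ InSplit P Q v → ¬ InSplit P Y v → ¬ InSplit (P ∪ Q) Y v
  no-split-interior {P} {Q} {Y} {u₁ = u₁} {v} {u₂} A u₁v vu₂ u₁≢u₂ PQ-ok PY-ok
                    (_ , _ , _ , ≢₁₂ , ≢₁₃ , ≢₂₃ , e₁ , e₂ , e₃) =
    three-among-two ≢₁₂ ≢₁₃ ≢₂₃ (neighbour e₁) (neighbour e₂) (neighbour e₃)
    where
    neighbour : ∀ {w} → ((P ∪ Q) ∪ Y) v w → w ≡ u₁ ⊎ w ≡ u₂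
    neighbour (inj₁ e) = trapped {F = Q} A u₁v vu₂ u₁≢u₂ PQ-ok e
    neighbour (inj₂ y) = trapped {F = Y} A u₁v vu₂ u₁≢u₂ PY-ok (inj₂ y)

  endpoint-besides : ∀ {E F xs zs a b} → Traces E xs → Traces F zs → E a b → F a b →
                     ∀ v → ∃[ a′ ] a′ ∈ xs × a′ ∈ zs × ¬ a′ ≡ v
  endpoint-besides {a = a} {b} A B ea fa v with a ≟ v
  ... | no a≢v    = a , edge⇒∈ A ea , edge⇒∈ B fa , a≢v
  ... | yes refl = b , edge⇒∈ A (edge-sym A ea) , edge⇒∈ B (edge-sym B fa) , λ b≡a → edge⇒≢ A ea (sym b≡a)

  -- P − v still connects an edge shared with Q to an edge shared with Y.
  meet-at-periphery : ∀ {P Q Y xs zs ys v ws} → Traces P xs → Traces Q zs → Traces Y ys →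
                      Along Adj ws → v ∉ ws → (∀ {z} → z ∈ xs → ¬ z ≡ v → z ∈ ws) →
                      v ∈ zs → v ∈ ys → Intersect P Q → Intersect P Y → Intersect Q Y
  meet-at-periphery {v = v} A B C adj v∉ws around v∈zs v∈ys (_ , _ , pab , qab) (_ , _ , pcd , ycd)
    with endpoint-besides A B pab qab v | endpoint-besides A C pcd ycd v
  ... | a′ , a′∈xs , a′∈zs , a′≢v | c′ , c′∈xs , c′∈ys , c′≢v
    with walk-within adj (around a′∈xs a′≢v) (around c′∈xs c′≢v)
  ...   | w , w⊆ws with common-edge-at B C v∈zs a′∈zs a′≢v v∈ys c′∈ys c′≢v w (λ v∈ → v∉ws (w⊆ws v∈))
  ...     | x , qvx , yvx = v , x , qvx , yvx

  no-split-union : ∀ {P Q Y xs zs ys} → Traces P xs → Traces Q zs → Traces Y ys →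
                   P ∼ Q → P ∼ Y → ¬ Intersect Q Y → ∀ v → ¬ InSplit (P ∪ Q) Y v
  no-split-union {P} {Q} {Y} {zs = zs} {ys} A B C (P∩Q , PQ-ok) (P∩Y , PY-ok) Q∩Y=∅ v split
    with v ∈? ys | v ∈? zs
  ... | no v∉ys | _ = PQ-ok v (InSplit-map {E = P ∪ Q} {F = Y} {E′ = P} {F′ = Q} off-Y split)
    where
    off-Y : ∀ {w} → ((P ∪ Q) ∪ Y) v w → (P ∪ Q) v w
    off-Y (inj₁ e) = e
    off-Y (inj₂ y) = ⊥-elim (v∉ys (edge⇒∈ C y))
  ... | yes _ | no v∉zs = PY-ok v (InSplit-map {E = P ∪ Q} {F = Y} {E′ = P} {F′ = Y} off-Q split)
    where
    off-Q : ∀ {w} → ((P ∪ Q) ∪ Y) v w → (P ∪ Y) v w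
    off-Q (inj₁ (inj₁ p)) = inj₁ p
    off-Q (inj₁ (inj₂ q)) = ⊥-elim (v∉zs (edge⇒∈ B q))
    off-Q (inj₂ y)        = inj₂ y
  ... | yes v∈ys | yes v∈zs with position (Traces.unique A) (Traces.adjacent A) v
  ...   | interior u₁v vu₂ u₁≢u₂ = no-split-interior {P} {Q} {Y} A u₁v vu₂ u₁≢u₂ (PQ-ok v) (PY-ok v) split
  ...   | peripheral _ adj v∉ws around = Q∩Y=∅ (meet-at-periphery A B C adj v∉ws around v∈zs v∈ys P∩Q P∩Y)

module Contraction {V : Set} (p q : V) where

  vtx-injective : {x y : Contracted V q} → vtx x ≡ vtx y → x ≡ y
  vtx-injective {⟨ _ , _ ⟩} {⟨ _ , _ ⟩} refl = refl

  vtx≢q : (x : Contracted V q) → ¬ vtx x ≡ q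
  vtx≢q ⟨ _ , ne ⟩ eq = Irrelevant.⊥-elim (ne eq)

  module _ {H : V → V → Set} (simple : IsSimpleGraph H) where

    Contract-comm : ∀ {x y} → Contract H p q x y ⇔ Contract H p q y x
    Contract-comm {x} {y} = mk⇔ (flip {x} {y}) (flip {y} {x})
      where
      flip : ∀ {x y} → Contract H p q x y → Contract H p q y x
      flip (x≢y , a , b , h , a↦x , b↦y) = ≢-sym x≢y , b , a , IsSimpleGraph.sym simple h , b↦y , a↦x

  module _ (H : V → V → Set) (x y : Contracted V q) where

    Contract-away : ¬ vtx x ≡ p → ¬ vtx y ≡ p → ¬ vtx x ≡ vtx y → Contract H p q x y ⇔ H (vtx x) (vtx y)
    Contract-away x≢p y≢p x≢y = mk⇔ to (λ h → x≢y , vtx x , vtx y , h , inj₁ refl , inj₁ refl)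
      where
      to : Contract H p q x y → H (vtx x) (vtx y)
      to (_ , _ , _ , h , inj₁ refl       , inj₁ refl)       = h
      to (_ , _ , _ , _ , inj₂ (_ , x≡p) , _)               = ⊥-elim (x≢p x≡p)
      to (_ , _ , _ , _ , _               , inj₂ (_ , y≡p)) = ⊥-elim (y≢p y≡p)

    Contract-merged : vtx x ≡ p → ¬ vtx y ≡ p → Contract H p q x y ⇔ (H p (vtx y) ⊎ H q (vtx y))
    Contract-merged x≡p y≢p = mk⇔ to from
      where
      x≢y : ¬ vtx x ≡ vtx y
      x≢y x≡y = y≢p (trans (sym x≡y) x≡p)
      to : Contract H p q x y → H p (vtx y) ⊎ H q (vtx y)
      to (_ , _ , _ , _ , _                , inj₂ (_ , y≡p)) = ⊥-elim (y≢p y≡p)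
      to (_ , _ , _ , h , inj₁ refl        , inj₁ refl)       = inj₁ (subst (λ a → H a (vtx y)) x≡p h)
      to (_ , _ , _ , h , inj₂ (refl , _)  , inj₁ refl)       = inj₂ h
      from : H p (vtx y) ⊎ H q (vtx y) → Contract H p q x y
      from (inj₁ h) = x≢y , p , vtx y , h , inj₁ (sym x≡p) , inj₁ refl
      from (inj₂ h) = x≢y , q , vtx y , h , inj₂ (refl , x≡p) , inj₁ refl

  module _ {n : ℕ} (P : V → EdgeSet n) (x : Contracted V q) where

    ContractPaths-merged : vtx x ≡ p → P p ∪ P q ≐ ContractPaths P p q x
    ContractPaths-merged x≡p = (λ e → inj₁ (x≡p , e)) , λ where
      (inj₁ (_ , e))   → e
      (inj₂ (x≢p , _)) → ⊥-elim (x≢p x≡p)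

    ContractPaths-away : ¬ vtx x ≡ p → P (vtx x) ≐ ContractPaths P p q x
    ContractPaths-away x≢p = (λ e → inj₂ (x≢p , e)) , λ where
      (inj₁ (x≡p , _)) → ⊥-elim (x≢p x≡p)
      (inj₂ (_ , e))   → e

module ContractedRepresentation {n} (T : Tree n) {V : Set} (_≟ⱽ_ : DecidableEquality V)
  (G G′ : V → V → Set) (simpleG : IsSimpleGraph G) (simpleG′ : IsSimpleGraph G′)
  (P : V → EdgeSet n) (rep : IsRepresentation T G G′ P)
  (p q : V) (pq∈G′ : G′ p q) (defined : ContractionDefined G G′ p q) where

  open TreePaths T
  open Contraction p q
  open import Relation.Binary.Reasoning.Setoid (⇔-setoid 0ℓ)

  P⁄ : Contracted V q → EdgeSet n
  P⁄ = ContractPaths P p q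

  G⇔ : ∀ u v → ¬ u ≡ v → G u v ⇔ Intersect (P u) (P v)
  G⇔ u v u≢v = proj₁ (proj₂ rep u v u≢v)

  G′⇔ : ∀ u v → ¬ u ≡ v → G′ u v ⇔ (P u ∼ P v)
  G′⇔ u v u≢v = proj₂ (proj₂ rep u v u≢v)

  traces : ∀ v → ∃ (Traces (P v))
  traces v = toTraces (proj₁ rep v)

  p≢q : ¬ p ≡ q
  p≢q refl = IsSimpleGraph.irrefl simpleG′ pq∈G′

  Pp∼Pq : P p ∼ P q
  Pp∼Pq = Equivalence.to (G′⇔ p q p≢q) pq∈G′

  merged-∼ : ∀ y → ¬ y ≡ p → ¬ y ≡ q → (P p ∪ P q) ∼ P y ⇔ (G′ p y ⊎ G′ q y)
  merged-∼ y y≢p y≢q = mk⇔ to from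
    where
    to : (P p ∪ P q) ∼ P y → G′ p y ⊎ G′ q y
    to merged∼Py@((a , b , inj₁ e , f) , _) =
      inj₁ (Equivalence.from (G′⇔ p y (≢-sym y≢p)) (∼-mono inj₁ id (a , b , e , f) merged∼Py))
    to merged∼Py@((a , b , inj₂ e , f) , _) =
      inj₂ (Equivalence.from (G′⇔ q y (≢-sym y≢q)) (∼-mono inj₂ id (a , b , e , f) merged∼Py))
    from : G′ p y ⊎ G′ q y → (P p ∪ P q) ∼ P y
    from (inj₁ py∈G′) =
      Intersect-mono inj₁ id (proj₁ Pp∼Py) ,
      no-split-union (proj₂ (traces p)) (proj₂ (traces q)) (proj₂ (traces y)) Pp∼Pq Pp∼Py
        (λ i → proj₁ defined y y≢q py∈G′ (Equivalence.from (G⇔ q y (≢-sym y≢q)) i))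
      where
      Pp∼Py = Equivalence.to (G′⇔ p y (≢-sym y≢p)) py∈G′
    from (inj₂ qy∈G′) = Equivalence.to (∼-cong ∪-comm ≐-refl)
      (Intersect-mono inj₁ id (proj₁ Pq∼Py) ,
       no-split-union (proj₂ (traces q)) (proj₂ (traces p)) (proj₂ (traces y)) (∼-sym Pp∼Pq) Pq∼Py
         (λ i → proj₂ defined y y≢p qy∈G′ (Equivalence.from (G⇔ p y (≢-sym y≢p)) i)))
      where
      Pq∼Py = Equivalence.to (G′⇔ q y (≢-sym y≢q)) qy∈G′

  contracted-paths : ∀ x → IsPath T (P⁄ x)
  contracted-paths x with vtx x ≟ⱽ p
  ... | yes x≡p = IsPath-cong (ContractPaths-merged P x x≡p) (union-path (proj₁ rep p) (proj₁ rep q) Pp∼Pq)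
  ... | no x≢p  = IsPath-cong (ContractPaths-away P x x≢p) (proj₁ rep (vtx x))

  Related : Contracted V q → Contracted V q → Set
  Related x y = (Contract G p q x y ⇔ Intersect (P⁄ x) (P⁄ y)) × (Contract G′ p q x y ⇔ (P⁄ x ∼ P⁄ y))

  related-comm : ∀ {x y} → Related x y → Related y x
  related-comm {x} {y} (G-rel , G′-rel) =
    (begin
      Contract G p q y x          ≈⟨ Contract-comm simpleG {y} {x} ⟩
      Contract G p q x y          ≈⟨ G-rel ⟩
      Intersect (P⁄ x) (P⁄ y)     ≈⟨ Intersect-comm ⟩
      Intersect (P⁄ y) (P⁄ x)     ∎) ,
    (begin
      Contract G′ p q y x         ≈⟨ Contract-comm simpleG′ {y} {x} ⟩
      Contract G′ p q x y         ≈⟨ G′-rel ⟩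
      (P⁄ x ∼ P⁄ y)               ≈⟨ ∼-comm ⟩
      (P⁄ y ∼ P⁄ x)               ∎)

  related-away : ∀ x y → ¬ vtx x ≡ p → ¬ vtx y ≡ p → ¬ vtx x ≡ vtx y → Related x y
  related-away x y x≢p y≢p x≢y =
    (begin
      Contract G p q x y              ≈⟨ Contract-away G x y x≢p y≢p x≢y ⟩
      G (vtx x) (vtx y)               ≈⟨ G⇔ (vtx x) (vtx y) x≢y ⟩
      Intersect (P (vtx x)) (P (vtx y)) ≈⟨ Intersect-cong (ContractPaths-away P x x≢p) (ContractPaths-away P y y≢p) ⟩
      Intersect (P⁄ x) (P⁄ y)         ∎) ,
    (begin
      Contract G′ p q x y             ≈⟨ Contract-away G′ x y x≢p y≢p x≢y ⟩
      G′ (vtx x) (vtx y)              ≈⟨ G′⇔ (vtx x) (vtx y) x≢y ⟩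
      (P (vtx x) ∼ P (vtx y))         ≈⟨ ∼-cong (ContractPaths-away P x x≢p) (ContractPaths-away P y y≢p) ⟩
      (P⁄ x ∼ P⁄ y)                   ∎)

  related-merged : ∀ x y → vtx x ≡ p → ¬ vtx y ≡ p → Related x y
  related-merged x y x≡p y≢p =
    (begin
      Contract G p q x y                ≈⟨ Contract-merged G x y x≡p y≢p ⟩
      (G p (vtx y) ⊎ G q (vtx y))       ≈⟨ G⇔ p (vtx y) (≢-sym y≢p) ⊎-⇔ G⇔ q (vtx y) (≢-sym (vtx≢q y)) ⟩
      (Intersect (P p) (P (vtx y)) ⊎ Intersect (P q) (P (vtx y))) ≈⟨ Intersect-∪ ⟨
      Intersect (P p ∪ P q) (P (vtx y)) ≈⟨ Intersect-cong (ContractPaths-merged P x x≡p) (ContractPaths-away P y y≢p) ⟩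
      Intersect (P⁄ x) (P⁄ y)           ∎) ,
    (begin
      Contract G′ p q x y               ≈⟨ Contract-merged G′ x y x≡p y≢p ⟩
      (G′ p (vtx y) ⊎ G′ q (vtx y))     ≈⟨ merged-∼ (vtx y) y≢p (vtx≢q y) ⟨
      (P p ∪ P q) ∼ P (vtx y)           ≈⟨ ∼-cong (ContractPaths-merged P x x≡p) (ContractPaths-away P y y≢p) ⟩
      (P⁄ x ∼ P⁄ y)                     ∎)

  contracted-related : ∀ x y → ¬ x ≡ y → Related x y
  contracted-related x y x≢y with vtx x ≟ⱽ p | vtx y ≟ⱽ p
  ... | yes x≡p | yes y≡p = ⊥-elim (x≢y (vtx-injective {x} {y} (trans x≡p (sym y≡p))))
  ... | yes x≡p | no y≢p  = related-merged x y x≡p y≢p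
  ... | no x≢p  | yes y≡p = related-comm {y} {x} (related-merged y x y≡p x≢p)
  ... | no x≢p  | no y≢p  = related-away x y x≢p y≢p (λ x≡y → x≢y (vtx-injective {x} {y} x≡y))

lemma6 : ∀ {n} (T : Tree n) {V : Set} → Finite V →
    (G G' : V → V → Set) → IsSimpleGraph G → IsSimpleGraph G' →
    (∀ {u v} → G' u v → G u v) →
    (P : V → EdgeSet n) → IsRepresentation T G G' P →
    (p q : V) → G' p q → ContractionDefined G G' p q →
    IsRepresentation T (Contract G p q) (Contract G' p q) (ContractPaths P p q)
lemma6 T (_ , Fin↔V) G G′ simpleG simpleG′ _ P rep p q pq∈G′ defined = contracted-paths , contracted-related
  where
  open ContractedRepresentation T (inj⇒≟ (↔⇒↣ (↔-sym Fin↔V))) G G′ simpleG simpleG′ P rep p q pq∈G′ defined
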